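{- Let $\tau$ be a positive integer such that $2^{2^\tau}-1$ has at least two distinct primitive prime divisors. For each $1\le j\le\tau$ let $p_j$ be a primitive prime divisor of $2^{2^j}-1$, and let $q$ be a primitive prime divisor of $2^{2^\tau}-1$ with $q\ne p_\tau$. Let $b>2$ be an integer with $b\not\equiv 0\pmod q$, and for each $1\le j\le\tau$ define $$\ell_j=\begin{cases}1 & \text{if } b\equiv 0\pmod{p_j},\\ p_j & \text{if } b\equiv 1\pmod{p_j},\\ \operatorname{ord}_{p_j}(b) & \text{otherwise},\end{cases}$$ and let $L=\operatorname{lcm}(2,\ell_1,\ldots,\ell_\tau)$. Suppose $b$ satisfies one of the following: (i) $b\equiv1\pmod q$ and $q\nmid L$; (ii) $b\not\equiv 1\pmod q$ and there exists an integer $t$ with $(b^t-1)/(b-1)\equiv -1\pmod q$ and $t\equiv 1\pmod L$. Then there exist infinitely many $b$-repunits that are Sierpiński numbers.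
   Context: For a positive integer $m$, a prime $p$ is a primitive prime divisor of $2^m-1$ if $p\mid 2^m-1$ and $p\nmid 2^\mu-1$ for every positive integer $\mu<m$. $\operatorname{ord}_p(b)$ is the multiplicative order of $b$ modulo $p$. For $b\ge2$ and $t\ge1$, the $b$-repunit $1_b^{(t)}$ is $(b^t-1)/(b-1)$. A Sierpiński number is an odd positive integer $k$ such that $k\cdot 2^n+1$ is composite for all positive integers $n$. -}

module Defs where

open import Data.Nat using (ℕ; zero; suc; _+_; _*_; _∸_; _^_; _≤_; _<_)
open import Data.Nat.Divisibility using (_∣_)
open import Data.Nat.Primality using (Prime; Composite)
open import Data.Nat.LCM using (lcm)
open import Data.Product using (_×_; ∃-syntax)
open import Relation.Nullary using (¬_)
open import Relation.Binary.PropositionalEquality using (_≡_)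

PrimitivePrimeDivisor : ℕ → ℕ → Set
PrimitivePrimeDivisor p m =
  Prime p × p ∣ (2 ^ m ∸ 1) × (∀ μ → 1 ≤ μ → μ < m → ¬ (p ∣ (2 ^ μ ∸ 1)))

IsOrd : ℕ → ℕ → ℕ → Set
IsOrd p b k =
  1 ≤ k × p ∣ (b ^ k ∸ 1) × (∀ m → 1 ≤ m → p ∣ (b ^ m ∸ 1) → k ≤ m)

-- the b-repunit (b^t - 1)/(b - 1) = 1 + b + ... + b^(t-1)
repunit : ℕ → ℕ → ℕ
repunit b zero = 0
repunit b (suc t) = 1 + b * repunit b t

Sierpinski : ℕ → Set
Sierpinski k = ¬ (2 ∣ k) × (∀ n → 1 ≤ n → Composite (k * 2 ^ n + 1))

IsEll : ℕ → ℕ → ℕ → Set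
IsEll p b l =
  (p ∣ b → l ≡ 1) × (p ∣ (b ∸ 1) → l ≡ p) ×
  (¬ (p ∣ b) → ¬ (p ∣ (b ∸ 1)) → IsOrd p b l)

lcm2UpTo : (ℕ → ℕ) → ℕ → ℕ
lcm2UpTo ℓ zero = 2
lcm2UpTo ℓ (suc n) = lcm (lcm2UpTo ℓ n) (ℓ (suc n))

{-# OPTIONS --safe #-}
module Submission where

-- Put k = R(s+1) = 1 + b·R(s), where R is the b-repunit.  If L ∣ s then k is odd and every
-- p_j divides b·R(s) = k - 1 (this is what the definition of ℓ_j is designed for); if
-- moreover q ∣ k + 1, then {p_1, ..., p_τ, q} is a covering set for k·2ⁿ + 1: when
-- n = 2^(j-1)·odd with j ≤ τ, p_j divides 2ⁿ + 1 and hence k·2ⁿ + 1, and when 2^τ ∣ n,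
-- q divides 2ⁿ - 1 and hence k·2ⁿ + 1.  One such s is s = t - 1 in case (ii); in case (i)
-- R(s+1) ≡ s + 1 (mod q), so s ≡ 0 (mod L), s ≡ -2 (mod q) is solvable as q ∤ L.  Since
-- q ∤ b, q divides some repunit R(o), and adding multiples of o·L to s keeps both
-- conditions, giving arbitrarily large Sierpiński repunits.

open import Defs
open import Data.Nat using (ℕ; zero; suc; _+_; _*_; _∸_; _^_; _≤_; _<_; z≤n; s≤s; z<s; NonZero; >-nonZero; >-nonZero⁻¹; ≢-nonZero; ≢-nonZero⁻¹; nonTrivial⇒≢1; NonTrivial)
open import Data.Nat.Properties
open import Data.Nat.Divisibility
open import Data.Nat.DivMod using (_%_; _/_; m≡m%n+[m/n]*n; m%n<n)
open import Data.Nat.Primality using (Prime; Composite; composite; euclidsLemma; prime⇒nonZero; prime⇒nonTrivial; prime⇒irreducible)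
open import Data.Nat.LCM using (lcm; m∣lcm[m,n]; n∣lcm[m,n]; gcd*lcm)
open import Data.Nat.GCD using (gcd; module Bézout)
open import Data.Nat.Coprimality using (Coprime; coprime-Bézout)
open import Data.Nat.Tactic.RingSolver using (solve-∀; solve)
open import Data.Fin using (Fin; toℕ; fromℕ<)
open import Data.Fin.Properties using (pigeonhole; toℕ-fromℕ<)
open import Data.List using (_∷_; [])
open import Data.Product using (_×_; ∃-syntax; _,_; proj₁; proj₂)
open import Data.Sum using (_⊎_; inj₁; inj₂; [_,_]′; map₂)
open import Relation.Nullary using (¬_; yes; no; contradiction)
open import Relation.Binary.PropositionalEquality using (_≡_; _≢_; refl; sym; trans; cong; subst; module ≡-Reasoning)

open ≡-Reasoning

even⊎odd : ∀ n → (∃[ m ] n ≡ 2 * m) ⊎ (∃[ m ] n ≡ 1 + 2 * m)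
even⊎odd zero = inj₁ (0 , refl)
even⊎odd (suc n) with even⊎odd n
... | inj₁ (m , refl) = inj₂ (m , refl)
... | inj₂ (m , refl) = inj₁ (suc m , cong suc (sym (+-suc m (m + 0))))

2^τ∣n⊎n≡2^j*odd : ∀ τ n .{{_ : NonZero n}} →
  2 ^ τ ∣ n ⊎ ∃[ j ] ∃[ m ] (j < τ × n ≡ 2 ^ j * (1 + 2 * m))
2^τ∣n⊎n≡2^j*odd zero n = inj₁ (1∣ n)
2^τ∣n⊎n≡2^j*odd (suc τ) n with even⊎odd n
... | inj₂ (m , n≡odd) = inj₂ (0 , m , z<s , trans n≡odd (sym (*-identityˡ _)))
... | inj₁ (m , refl) with 2^τ∣n⊎n≡2^j*odd τ m {{m*n≢0⇒n≢0 2}}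
...   | inj₁ 2^τ∣m = inj₁ (*-monoʳ-∣ 2 2^τ∣m)
...   | inj₂ (j , k , j<τ , refl) = inj₂ (suc j , k , s≤s j<τ , sym (*-assoc 2 (2 ^ j) _))

repunit-+ : ∀ b m n → repunit b (m + n) ≡ repunit b m + b ^ m * repunit b n
repunit-+ b zero n = sym (+-identityʳ _)
repunit-+ b (suc m) n = begin
  1 + b * repunit b (m + n)                           ≡⟨ cong (λ r → 1 + b * r) (repunit-+ b m n) ⟩
  1 + b * (repunit b m + b ^ m * repunit b n)         ≡⟨ distrib b (repunit b m) (b ^ m) (repunit b n) ⟩
  (1 + b * repunit b m) + b * b ^ m * repunit b n     ∎
  where
  distrib : ∀ b r x y → 1 + b * (r + x * y) ≡ (1 + b * r) + b * x * y
  distrib = solve-∀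

repunit-pres-∣ : ∀ b {o x} → o ∣ x → repunit b o ∣ repunit b x
repunit-pres-∣ b {o} (divides-refl c) = go c
  where
  go : ∀ c → repunit b o ∣ repunit b (c * o)
  go zero = _ ∣0
  go (suc c) = subst (repunit b o ∣_) (sym (repunit-+ b o (c * o)))
                 (∣m∣n⇒∣m+n ∣-refl (∣n⇒∣m*n (b ^ o) (go c)))

repunit-2 : ∀ b → repunit b 2 ≡ b + 1
repunit-2 b = trans (cong (λ r → 1 + b * suc r) (*-zeroʳ b)) (trans (cong suc (*-identityʳ b)) (+-comm 1 b))

repunit≡t+a*c : ∀ a t → ∃[ c ] repunit (suc a) t ≡ t + a * c
repunit≡t+a*c a zero = 0 , sym (*-zeroʳ a)
repunit≡t+a*c a (suc t) with c , R≡ ← repunit≡t+a*c a t = t + c + a * c , (begin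
  1 + suc a * repunit (suc a) t     ≡⟨ cong (λ r → 1 + suc a * r) R≡ ⟩
  1 + (1 + a) * (t + a * c)         ≡⟨ solve (a ∷ t ∷ c ∷ []) ⟩
  (1 + t) + a * (t + c + a * c)     ∎)

∣a∧∣t⇒∣repunit[1+a] : ∀ {d a t} → d ∣ a → d ∣ t → d ∣ repunit (suc a) t
∣a∧∣t⇒∣repunit[1+a] {d} {a} {t} d∣a d∣t with c , R≡ ← repunit≡t+a*c a t =
  subst (d ∣_) (sym R≡) (∣m∣n⇒∣m+n d∣t (∣m⇒∣m*n c d∣a))

∣a∧∣t+1⇒∣repunit[1+a]+1 : ∀ {d a t} → d ∣ a → d ∣ t + 1 → d ∣ repunit (suc a) t + 1
∣a∧∣t+1⇒∣repunit[1+a]+1 {d} {a} {t} d∣a d∣t+1 with c , R≡ ← repunit≡t+a*c a t =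
  subst (d ∣_) rearrange (∣m∣n⇒∣m+n d∣t+1 (∣m⇒∣m*n c d∣a))
  where
  rearrange : t + 1 + a * c ≡ repunit (suc a) t + 1
  rearrange = begin
    t + 1 + a * c          ≡⟨ solve (t ∷ a ∷ c ∷ []) ⟩
    t + a * c + 1          ≡⟨ cong (_+ 1) (sym R≡) ⟩
    repunit (suc a) t + 1  ∎

a*repunit[1+a]+1≡[1+a]^t : ∀ a t → a * repunit (suc a) t + 1 ≡ suc a ^ t
a*repunit[1+a]+1≡[1+a]^t a zero = cong (_+ 1) (*-zeroʳ a)
a*repunit[1+a]+1≡[1+a]^t a (suc t) = begin
  a * (1 + suc a * repunit (suc a) t) + 1   ≡⟨ factor a (repunit (suc a) t) ⟩
  suc a * (a * repunit (suc a) t + 1)       ≡⟨ cong (suc a *_) (a*repunit[1+a]+1≡[1+a]^t a t) ⟩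
  suc a * suc a ^ t                         ∎
  where
  factor : ∀ a r → a * (1 + (1 + a) * r) + 1 ≡ (1 + a) * (a * r + 1)
  factor = solve-∀

[1+a]^t∸1≡a*repunit[1+a] : ∀ a t → suc a ^ t ∸ 1 ≡ a * repunit (suc a) t
[1+a]^t∸1≡a*repunit[1+a] a t =
  trans (cong (_∸ 1) (sym (a*repunit[1+a]+1≡[1+a]^t a t))) (m+n∸n≡m _ 1)

t≤repunit[1+a] : ∀ a t → t ≤ repunit (suc a) t
t≤repunit[1+a] a t with c , R≡ ← repunit≡t+a*c a t = subst (t ≤_) (sym R≡) (m≤m+n t (a * c))

m∸1∣m^n∸1 : ∀ m n → m ∸ 1 ∣ m ^ n ∸ 1
m∸1∣m^n∸1 zero zero = ∣-refl
m∸1∣m^n∸1 zero (suc n) = ∣-refl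
m∸1∣m^n∸1 (suc a) n = subst (a ∣_) (sym ([1+a]^t∸1≡a*repunit[1+a] a n)) (m∣m*n _)

b^m∸1∣b^n∸1 : ∀ b {m n} → m ∣ n → b ^ m ∸ 1 ∣ b ^ n ∸ 1
b^m∸1∣b^n∸1 b {m} (divides-refl c) =
  subst (λ e → b ^ m ∸ 1 ∣ e ∸ 1) (trans (^-*-assoc b m c) (cong (b ^_) (*-comm m c)))
    (m∸1∣m^n∸1 (b ^ m) c)

m+1∣m^odd+1 : ∀ m k → m + 1 ∣ m ^ (1 + 2 * k) + 1
m+1∣m^odd+1 m zero = subst (λ e → m + 1 ∣ e + 1) (sym (*-identityʳ m)) ∣-refl
m+1∣m^odd+1 zero (suc k) = 1∣ _
m+1∣m^odd+1 (suc z) (suc k) = ∣m+n∣m⇒∣n (subst (suc z + 1 ∣_) (sym rearrange) Y²[Y^odd+1])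
                                         (∣n⇒∣m*n z ∣-refl)
  where
  Y e : ℕ
  Y = suc z
  e = Y ^ (1 + 2 * k)
  Y²[Y^odd+1] : Y + 1 ∣ Y * Y * (e + 1)
  Y²[Y^odd+1] = ∣n⇒∣m*n (Y * Y) (m+1∣m^odd+1 Y k)
  rearrange : z * (Y + 1) + (Y ^ (1 + 2 * suc k) + 1) ≡ Y * Y * (e + 1)
  rearrange = begin
    z * (Y + 1) + (Y ^ (1 + 2 * suc k) + 1)   ≡⟨ cong (λ x → z * (Y + 1) + (Y ^ x + 1)) (odd-step k) ⟩
    z * (Y + 1) + (Y ^ (2 + (1 + 2 * k)) + 1) ≡⟨ cong (λ x → z * (Y + 1) + (x + 1)) (^-distribˡ-+-* Y 2 (1 + 2 * k)) ⟩
    z * (Y + 1) + (Y * (Y * 1) * e + 1)       ≡⟨ factor z e ⟩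
    Y * Y * (e + 1)                           ∎
    where
    odd-step : ∀ k → 1 + 2 * (1 + k) ≡ 2 + (1 + 2 * k)
    odd-step = solve-∀
    factor : ∀ z e → z * (1 + z + 1) + ((1 + z) * ((1 + z) * 1) * e + 1) ≡ (1 + z) * (1 + z) * (e + 1)
    factor = solve-∀

m%d≡[m+n]%d⇒d∣n : ∀ m n d .{{_ : NonZero d}} → m % d ≡ (m + n) % d → d ∣ n
m%d≡[m+n]%d⇒d∣n m n d same = ∣m+n∣m⇒∣n (divides ((m + n) / d) (+-cancelˡ-≡ (m % d) _ _ (begin
  m % d + (m / d * d + n)         ≡⟨ sym (+-assoc (m % d) _ n) ⟩
  m % d + m / d * d + n           ≡⟨ cong (_+ n) (sym (m≡m%n+[m/n]*n m d)) ⟩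
  m + n                           ≡⟨ m≡m%n+[m/n]*n (m + n) d ⟩
  (m + n) % d + (m + n) / d * d   ≡⟨ cong (_+ (m + n) / d * d) (sym same) ⟩
  m % d + (m + n) / d * d         ∎)))
  (n∣m*n (m / d))

prime∤m⇒∤m^n : ∀ {p m} n → Prime p → ¬ p ∣ m → ¬ p ∣ m ^ n
prime∤m⇒∤m^n zero p-prime _ p∣1 = contradiction (∣1⇒≡1 p∣1) (nonTrivial⇒≢1 {{prime⇒nonTrivial p-prime}})
prime∤m⇒∤m^n (suc n) p-prime p∤m p∣m^[1+n] with euclidsLemma _ _ p-prime p∣m^[1+n]
... | inj₁ p∣m = p∤m p∣m
... | inj₂ p∣m^n = prime∤m⇒∤m^n n p-prime p∤m p∣m^n

repunit-period : ∀ {q} b → Prime q → ¬ q ∣ b → ∃[ o ] q ∣ repunit b (suc o)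
repunit-period {q} b q-prime q∤b = period (pigeonhole (n<1+n q) residue)
  where
  instance
    q≢0 : NonZero q
    q≢0 = prime⇒nonZero q-prime
  residue : Fin (suc q) → Fin q
  residue i = fromℕ< (m%n<n (repunit b (toℕ i)) q)
  period : ∃[ i ] ∃[ j ] (toℕ i < toℕ j × residue i ≡ residue j) → ∃[ o ] q ∣ repunit b (suc o)
  period (i , j , i<j , same) with o , i+1+o≡j ← m≤n⇒∃[o]m+o≡n i<j = o , q∣R[1+o]
    where
    same% : repunit b (toℕ i) % q ≡ (repunit b (toℕ i) + b ^ toℕ i * repunit b (suc o)) % q
    same% = begin
      repunit b (toℕ i) % q             ≡⟨ sym (toℕ-fromℕ< _) ⟩
      toℕ (residue i)                   ≡⟨ cong toℕ same ⟩
      toℕ (residue j)                   ≡⟨ toℕ-fromℕ< _ ⟩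
      repunit b (toℕ j) % q             ≡⟨ cong (λ x → repunit b x % q) (trans (sym i+1+o≡j) (sym (+-suc (toℕ i) o))) ⟩
      repunit b (toℕ i + suc o) % q     ≡⟨ cong (_% q) (repunit-+ b (toℕ i) (suc o)) ⟩
      (repunit b (toℕ i) + b ^ toℕ i * repunit b (suc o)) % q ∎
    q∣R[1+o] : q ∣ repunit b (suc o)
    q∣R[1+o] with euclidsLemma (b ^ toℕ i) _ q-prime (m%d≡[m+n]%d⇒d∣n _ _ q same%)
    ... | inj₁ q∣b^i = contradiction q∣b^i (prime∤m⇒∤m^n (toℕ i) q-prime q∤b)
    ... | inj₂ q∣R = q∣R

∣m^2∸1⇒∣m∸1⊎∣m+1 : ∀ {p} m → Prime p → p ∣ m ^ 2 ∸ 1 → p ∣ m ∸ 1 ⊎ p ∣ m + 1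
∣m^2∸1⇒∣m∸1⊎∣m+1 zero _ _ = inj₁ (_ ∣0)
∣m^2∸1⇒∣m∸1⊎∣m+1 {p} (suc a) p-prime p∣ =
  map₂ (subst (p ∣_) (repunit-2 (suc a)))
    (euclidsLemma a _ p-prime (subst (p ∣_) ([1+a]^t∸1≡a*repunit[1+a] a 2) p∣))

ppd⇒∣2^m+1 : ∀ {p} m .{{_ : NonZero m}} → PrimitivePrimeDivisor p (2 * m) → p ∣ 2 ^ m + 1
ppd⇒∣2^m+1 {p} m (p-prime , p∣2^2m∸1 , p-primitive)
  with ∣m^2∸1⇒∣m∸1⊎∣m+1 (2 ^ m) p-prime
         (subst (λ e → p ∣ e ∸ 1) (sym (^-*-assoc 2 m 2)) (subst (λ e → p ∣ 2 ^ e ∸ 1) (*-comm 2 m) p∣2^2m∸1))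
... | inj₁ p∣2^m∸1 = contradiction p∣2^m∸1
                       (p-primitive m (>-nonZero⁻¹ m) (subst (m <_) (*-comm m 2) (m<m*n m 2 (s≤s (s≤s z≤n)))))
... | inj₂ p∣2^m+1 = p∣2^m+1

small-prime-factor⇒composite : ∀ {d} k w .{{_ : NonZero k}} →
  Prime d → d ∣ k * w + 1 → d ≤ k + 1 → 2 ≤ w → Composite (k * w + 1)
small-prime-factor⇒composite {d} k w d-prime d∣ d≤k+1 2≤w =
  composite (≤-<-trans (≤-trans d≤k+1 k+1≤k*w) (m<m+n (k * w) z<s)) d∣
  where
  instance
    d-nonTrivial : NonTrivial d
    d-nonTrivial = prime⇒nonTrivial d-prime
  k+1≤k*w : k + 1 ≤ k * w
  k+1≤k*w = ≤-trans (+-monoʳ-≤ k (>-nonZero⁻¹ k))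
              (subst (_≤ k * w) (trans (*-comm k 2) (cong (k +_) (+-identityʳ k))) (*-monoʳ-≤ k 2≤w))

∣w∸1⇒∣k+1⇒∣k*w+1 : ∀ {d} k w .{{_ : NonZero w}} → d ∣ w ∸ 1 → d ∣ k + 1 → d ∣ k * w + 1
∣w∸1⇒∣k+1⇒∣k*w+1 {d} k (suc v) d∣v d∣k+1 =
  subst (d ∣_) (sym (rearrange k v)) (∣m∣n⇒∣m+n (∣n⇒∣m*n k d∣v) d∣k+1)
  where
  rearrange : ∀ k v → k * (1 + v) + 1 ≡ k * v + (k + 1)
  rearrange = solve-∀

∣B⇒∣w+1⇒∣[1+B]*w+1 : ∀ {d} B w → d ∣ B → d ∣ w + 1 → d ∣ suc B * w + 1
∣B⇒∣w+1⇒∣[1+B]*w+1 {d} B w d∣B d∣w+1 =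
  subst (d ∣_) (sym (rearrange B w)) (∣m∣n⇒∣m+n (∣m⇒∣m*n w d∣B) d∣w+1)
  where
  rearrange : ∀ B w → (1 + B) * w + 1 ≡ B * w + (w + 1)
  rearrange = solve-∀

covering⇒sierpinski : ∀ τ (p : ℕ → ℕ) {q} B .{{_ : NonZero B}} →
  (∀ j → 1 ≤ j → j ≤ τ → PrimitivePrimeDivisor (p j) (2 ^ j)) →
  (∀ j → 1 ≤ j → j ≤ τ → p j ∣ B) →
  Prime q → q ∣ 2 ^ 2 ^ τ ∸ 1 → q ∣ suc B + 1 → 2 ∣ B →
  Sierpinski (suc B)
covering⇒sierpinski τ p {q} B ppd p∣B q-prime q∣2^2^τ∸1 q∣k+1 2∣B = odd , composite-at
  where
  odd : ¬ 2 ∣ suc B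
  odd 2∣k = contradiction (∣1⇒≡1 (∣m+n∣m⇒∣n (subst (2 ∣_) (+-comm 1 B) 2∣k) 2∣B)) λ ()
  composite-at : ∀ n → 1 ≤ n → Composite (suc B * 2 ^ n + 1)
  composite-at n 1≤n with 2^τ∣n⊎n≡2^j*odd τ n {{>-nonZero 1≤n}}
  ... | inj₁ 2^τ∣n =
    small-prime-factor⇒composite (suc B) (2 ^ n) q-prime
      (∣w∸1⇒∣k+1⇒∣k*w+1 (suc B) (2 ^ n) {{m^n≢0 2 n}} (∣-trans q∣2^2^τ∸1 (b^m∸1∣b^n∸1 2 2^τ∣n)) q∣k+1)
      (∣⇒≤ q∣k+1) (^-monoʳ-≤ 2 1≤n)
  ... | inj₂ (j , m , j<τ , refl) =
    small-prime-factor⇒composite (suc B) (2 ^ n) (proj₁ (ppd (suc j) (s≤s z≤n) j<τ))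
      (∣B⇒∣w+1⇒∣[1+B]*w+1 B (2 ^ n) P∣B (∣-trans P∣Y+1 Y+1∣2^n+1))
      (≤-trans (∣⇒≤ P∣B) (≤-trans (n≤1+n B) (m≤m+n (suc B) 1))) (^-monoʳ-≤ 2 1≤n)
    where
    P∣B : p (suc j) ∣ B
    P∣B = p∣B (suc j) (s≤s z≤n) j<τ
    P∣Y+1 : p (suc j) ∣ 2 ^ 2 ^ j + 1
    P∣Y+1 = ppd⇒∣2^m+1 (2 ^ j) {{m^n≢0 2 j}} (ppd (suc j) (s≤s z≤n) j<τ)
    Y+1∣2^n+1 : 2 ^ 2 ^ j + 1 ∣ 2 ^ n + 1
    Y+1∣2^n+1 = subst (λ e → 2 ^ 2 ^ j + 1 ∣ e + 1) (^-*-assoc 2 (2 ^ j) (1 + 2 * m)) (m+1∣m^odd+1 (2 ^ 2 ^ j) m)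

IsEll⇒nonZero : ∀ {p b l} → Prime p → IsEll p b l → NonZero l
IsEll⇒nonZero {p} {b} p-prime (ℓ-div , ℓ-unit , ℓ-ord) with p ∣? b | p ∣? b ∸ 1
... | yes p∣b | _        = subst NonZero (sym (ℓ-div p∣b)) (>-nonZero z<s)
... | no _    | yes p∣b-1 = subst NonZero (sym (ℓ-unit p∣b-1)) (prime⇒nonZero p-prime)
... | no p∤b  | no p∤b-1  = >-nonZero (proj₁ (ℓ-ord p∤b p∤b-1))

IsEll⇒∣b*repunit : ∀ {p a l s} → Prime p → IsEll p (suc a) l → l ∣ s → p ∣ suc a * repunit (suc a) s
IsEll⇒∣b*repunit {p} {a} {l} p-prime (ℓ-div , ℓ-unit , ℓ-ord) l∣s with p ∣? suc a | p ∣? a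
... | yes p∣b | _ = ∣m⇒∣m*n _ p∣b
... | no _ | yes p∣a = ∣n⇒∣m*n (suc a) (∣a∧∣t⇒∣repunit[1+a] p∣a (subst (_∣ _) (ℓ-unit p∣a) l∣s))
... | no p∤b | no p∤a
  with euclidsLemma a (repunit (suc a) l) p-prime
         (subst (p ∣_) ([1+a]^t∸1≡a*repunit[1+a] a l) (proj₁ (proj₂ (ℓ-ord p∤b p∤a))))
...   | inj₁ p∣a = contradiction p∣a p∤a
...   | inj₂ p∣R = ∣n⇒∣m*n (suc a) (∣-trans p∣R (repunit-pres-∣ (suc a) l∣s))

2∣s⇒2∣b*repunit : ∀ a {s} → 2 ∣ s → 2 ∣ suc a * repunit (suc a) s
2∣s⇒2∣b*repunit a {s} 2∣s with even⊎odd a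
... | inj₁ (m , refl) = ∣n⇒∣m*n (suc (2 * m)) (∣a∧∣t⇒∣repunit[1+a] (m∣m*n m) 2∣s)
... | inj₂ (m , refl) = ∣m⇒∣m*n (repunit _ s) (∣m∣n⇒∣m+n ∣-refl (m∣m*n m))

ℓ∣lcm2UpTo : ∀ ℓ τ {j} → 1 ≤ j → j ≤ τ → ℓ j ∣ lcm2UpTo ℓ τ
ℓ∣lcm2UpTo ℓ zero 1≤j j≤0 = contradiction (≤-trans 1≤j j≤0) λ ()
ℓ∣lcm2UpTo ℓ (suc τ) 1≤j j≤1+τ with m≤n⇒m<n∨m≡n j≤1+τ
... | inj₂ refl = n∣lcm[m,n] (lcm2UpTo ℓ τ) (ℓ (suc τ))
... | inj₁ (s≤s j≤τ) = ∣-trans (ℓ∣lcm2UpTo ℓ τ 1≤j j≤τ) (m∣lcm[m,n] (lcm2UpTo ℓ τ) (ℓ (suc τ)))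

2∣lcm2UpTo : ∀ ℓ τ → 2 ∣ lcm2UpTo ℓ τ
2∣lcm2UpTo ℓ zero = ∣-refl
2∣lcm2UpTo ℓ (suc τ) = ∣-trans (2∣lcm2UpTo ℓ τ) (m∣lcm[m,n] (lcm2UpTo ℓ τ) (ℓ (suc τ)))

lcm-nonZero : ∀ m n .{{_ : NonZero m}} .{{_ : NonZero n}} → NonZero (lcm m n)
lcm-nonZero m n = ≢-nonZero λ lcm≡0 → ≢-nonZero⁻¹ (m * n) {{m*n≢0 m n}} (begin
  m * n               ≡⟨ sym (gcd*lcm m n) ⟩
  gcd m n * lcm m n   ≡⟨ cong (gcd m n *_) lcm≡0 ⟩
  gcd m n * 0         ≡⟨ *-zeroʳ (gcd m n) ⟩
  0                   ∎)

lcm2UpTo-nonZero : ∀ ℓ τ → (∀ j → 1 ≤ j → j ≤ τ → NonZero (ℓ j)) → NonZero (lcm2UpTo ℓ τ)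
lcm2UpTo-nonZero ℓ zero _ = _
lcm2UpTo-nonZero ℓ (suc τ) ℓ≢0 =
  lcm-nonZero _ _ {{lcm2UpTo-nonZero ℓ τ λ j 1≤j j≤τ → ℓ≢0 j 1≤j (m≤n⇒m≤1+n j≤τ)}} {{ℓ≢0 (suc τ) z<s ≤-refl}}

repunit-sierpinski : ∀ τ (p ℓ : ℕ → ℕ) {q} a s .{{_ : NonZero s}} →
  (∀ j → 1 ≤ j → j ≤ τ → PrimitivePrimeDivisor (p j) (2 ^ j)) →
  (∀ j → 1 ≤ j → j ≤ τ → IsEll (p j) (suc a) (ℓ j)) →
  Prime q → q ∣ 2 ^ 2 ^ τ ∸ 1 →
  lcm2UpTo ℓ τ ∣ s → q ∣ repunit (suc a) (suc s) + 1 → Sierpinski (repunit (suc a) (suc s))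
repunit-sierpinski τ p ℓ a s@(suc _) ppd ell q-prime q∣2^2^τ∸1 L∣s q∣k+1 =
  covering⇒sierpinski τ p (suc a * repunit (suc a) s) ppd p∣B q-prime q∣2^2^τ∸1 q∣k+1
    (2∣s⇒2∣b*repunit a (∣-trans (2∣lcm2UpTo ℓ τ) L∣s))
  where
  p∣B : ∀ j → 1 ≤ j → j ≤ τ → p j ∣ suc a * repunit (suc a) s
  p∣B j 1≤j j≤τ = IsEll⇒∣b*repunit (proj₁ (ppd j 1≤j j≤τ)) (ell j 1≤j j≤τ)
                    (∣-trans (ℓ∣lcm2UpTo ℓ τ 1≤j j≤τ) L∣s)

prime∤⇒coprime : ∀ {p n} → Prime p → ¬ p ∣ n → Coprime p n
prime∤⇒coprime p-prime p∤n (d∣p , d∣n) with prime⇒irreducible p-prime d∣p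
... | inj₁ d≡1 = d≡1
... | inj₂ refl = contradiction d∣n p∤n

coprime⇒∣c+M*L : ∀ {q L} .{{_ : NonZero q}} → Coprime q L → ∀ c → ∃[ M ] q ∣ c + M * L
coprime⇒∣c+M*L {suc r} {L} q⊥L c with coprime-Bézout q⊥L
... | Bézout.+- x y 1+yL≡xq = c * y , divides (c * x) (begin
  c + c * y * L       ≡⟨ solve (c ∷ y ∷ L ∷ []) ⟩
  c * (1 + y * L)     ≡⟨ cong (c *_) 1+yL≡xq ⟩
  c * (x * suc r)     ≡⟨ sym (*-assoc c x (suc r)) ⟩
  c * x * suc r       ∎)
... | Bézout.-+ x y 1+xq≡yL = r * c * y , divides (c + r * c * x) (begin
  c + r * c * y * L             ≡⟨ cong (c +_) (*-assoc (r * c) y L) ⟩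
  c + r * c * (y * L)           ≡⟨ cong (λ e → c + r * c * e) (sym 1+xq≡yL) ⟩
  c + r * c * (1 + x * suc r)   ≡⟨ solve (c ∷ r ∷ x ∷ []) ⟩
  (c + r * c * x) * suc r       ∎)

∣b∸1⇒repunit+1-seed : ∀ {q a L} → Prime q → q ∣ a → ¬ q ∣ L →
  ∃[ s₀ ] (L ∣ s₀ × q ∣ repunit (suc a) (suc s₀) + 1)
∣b∸1⇒repunit+1-seed {q} {a} {L} q-prime q∣a q∤L
  with M , q∣2+ML ← coprime⇒∣c+M*L {{prime⇒nonZero q-prime}} (prime∤⇒coprime q-prime q∤L) 2 =
  M * L , n∣m*n M ,
  ∣a∧∣t+1⇒∣repunit[1+a]+1 {t = suc (M * L)} q∣a (subst (q ∣_) (cong suc (+-comm 1 (M * L))) q∣2+ML)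

repunit+1-periodic : ∀ {q} b {o t X} → q ∣ repunit b o → o ∣ X →
  q ∣ repunit b t + 1 → q ∣ repunit b (t + X) + 1
repunit+1-periodic {q} b {o} {t} {X} q∣Ro o∣X q∣Rt+1 =
  subst (q ∣_) (sym rearrange) (∣m∣n⇒∣m+n q∣Rt+1 (∣n⇒∣m*n (b ^ t) (∣-trans q∣Ro (repunit-pres-∣ b o∣X))))
  where
  rearrange : repunit b (t + X) + 1 ≡ (repunit b t + 1) + b ^ t * repunit b X
  rearrange = begin
    repunit b (t + X) + 1                     ≡⟨ cong (_+ 1) (repunit-+ b t X) ⟩
    repunit b t + b ^ t * repunit b X + 1     ≡⟨ +-assoc (repunit b t) _ 1 ⟩
    repunit b t + (b ^ t * repunit b X + 1)   ≡⟨ cong (repunit b t +_) (+-comm _ 1) ⟩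
    repunit b t + (1 + b ^ t * repunit b X)   ≡⟨ sym (+-assoc (repunit b t) 1 _) ⟩
    (repunit b t + 1) + b ^ t * repunit b X   ∎

unbounded-solutions : ∀ {q b L s₀} .{{_ : NonZero L}} → Prime q → ¬ q ∣ b →
  L ∣ s₀ → q ∣ repunit b (suc s₀) + 1 →
  ∀ N → ∃[ s ] (N < s × L ∣ s × q ∣ repunit b (suc s) + 1)
unbounded-solutions {q} {b} {L} {s₀} q-prime q∤b L∣s₀ q∣R+1 N = pump (repunit-period b q-prime q∤b)
  where
  pump : ∃[ o ] q ∣ repunit b (suc o) → ∃[ s ] (N < s × L ∣ s × q ∣ repunit b (suc s) + 1)
  pump (o , q∣R[1+o]) =
    s₀ + X , N<s₀+X , ∣m∣n⇒∣m+n L∣s₀ (∣n⇒∣m*n (suc N) (n∣m*n (suc o))) ,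
    repunit+1-periodic b {suc o} {suc s₀} q∣R[1+o] (∣n⇒∣m*n (suc N) (m∣m*n L)) q∣R+1
    where
    X : ℕ
    X = suc N * (suc o * L)
    N<s₀+X : N < s₀ + X
    N<s₀+X = ≤-trans (m≤m*n (suc N) (suc o * L) {{m*n≢0 (suc o) L}}) (m≤n+m X s₀)

-- Only b ≢ 0, q ∤ b, q prime with q ∣ 2^2^τ - 1, the p_j, the ℓ_j and (i)/(ii) are used.
theorem3p11 : (τ : ℕ) → 1 ≤ τ →
    (∃[ r ] ∃[ s ] (r ≢ s × PrimitivePrimeDivisor r (2 ^ τ) × PrimitivePrimeDivisor s (2 ^ τ))) →
    (p : ℕ → ℕ) → (∀ j → 1 ≤ j → j ≤ τ → PrimitivePrimeDivisor (p j) (2 ^ j)) →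
    (q : ℕ) → PrimitivePrimeDivisor q (2 ^ τ) → q ≢ p τ →
    (b : ℕ) → 2 < b → ¬ (q ∣ b) →
    (ℓ : ℕ → ℕ) → (∀ j → 1 ≤ j → j ≤ τ → IsEll (p j) b (ℓ j)) →
    ((q ∣ (b ∸ 1) × ¬ (q ∣ lcm2UpTo ℓ τ))
      ⊎ (¬ (q ∣ (b ∸ 1)) × ∃[ t ] (1 ≤ t × q ∣ (repunit b t + 1) × lcm2UpTo ℓ τ ∣ (t ∸ 1)))) →
    ∀ N → ∃[ t ] (N < repunit b t × Sierpinski (repunit b t))
theorem3p11 _ _ _ _ _ _ _ _ zero () _ _ _ _ _
theorem3p11 τ _ _ p ppd q (q-prime , q∣2^2^τ∸1 , _) _ (suc a) _ q∤b ℓ ell case N =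
  let s₀ , L∣s₀ , q∣R[1+s₀]+1 = seed
      s , N<s , L∣s , q∣R[1+s]+1 = unbounded-solutions {{L≢0}} q-prime q∤b L∣s₀ q∣R[1+s₀]+1 N
  in suc s , <-≤-trans N<s (≤-trans (n≤1+n s) (t≤repunit[1+a] a (suc s))) ,
     repunit-sierpinski τ p ℓ a s {{>-nonZero (≤-<-trans z≤n N<s)}} ppd ell q-prime q∣2^2^τ∸1 L∣s q∣R[1+s]+1
  where
  L : ℕ
  L = lcm2UpTo ℓ τ
  L≢0 : NonZero L
  L≢0 = lcm2UpTo-nonZero ℓ τ λ j 1≤j j≤τ → IsEll⇒nonZero (proj₁ (ppd j 1≤j j≤τ)) (ell j 1≤j j≤τ)
  seed : ∃[ s₀ ] (L ∣ s₀ × q ∣ repunit (suc a) (suc s₀) + 1)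
  seed = [ from-i , from-ii ]′ case
    where
    from-i : q ∣ a × ¬ q ∣ L → ∃[ s₀ ] (L ∣ s₀ × q ∣ repunit (suc a) (suc s₀) + 1)
    from-i (q∣a , q∤L) = ∣b∸1⇒repunit+1-seed q-prime q∣a q∤L
    from-ii : ¬ q ∣ a × ∃[ t ] (1 ≤ t × q ∣ repunit (suc a) t + 1 × L ∣ t ∸ 1) →
              ∃[ s₀ ] (L ∣ s₀ × q ∣ repunit (suc a) (suc s₀) + 1)
    from-ii (_ , zero , () , _)
    from-ii (_ , suc s₀ , _ , q∣R+1 , L∣s₀) = s₀ , L∣s₀ , q∣R+1
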